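{- For $n \geq 4$ and $k \geq 2$ we have $ex(n;k) = \lfloor \frac{n^2}{4} \rfloor$.
   Context: A digraph has a vertex set and an arc set consisting of ordered pairs of distinct vertices. A walk of length $\ell$ is a sequence $x_0x_1\dots x_\ell$ of vertices with $x_i \rightarrow x_{i+1}$ for all $i$. A digraph is $k$-geodetic if for every ordered pair $(u,v)$ of (not necessarily distinct) vertices there is at most one $u,v$-walk of length at most $k$. For $n,k\ge 2$, $ex(n;k)$ is the largest possible number of arcs of a $k$-geodetic digraph on $n$ vertices. -}

module Defs where

open import Data.Nat using (ℕ; zero; suc; _+_; _*_; _≤_)
open import Data.Nat.DivMod using (_/_)
open import Data.Bool using (Bool; true; false; if_then_else_)
open import Data.Fin using (Fin)
open import Data.List using (List; []; _∷_; length; map; allFin)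
open import Data.Nat.ListAction using (sum)
open import Data.Product using (Σ; _×_)
open import Relation.Binary.PropositionalEquality using (_≡_)

record Digraph (n : ℕ) : Set where
  field
    adj      : Fin n → Fin n → Bool
    loopless : ∀ u → adj u u ≡ false
open Digraph public

Arc : ∀ {n} → Digraph n → Fin n → Fin n → Set
Arc G u v = adj G u v ≡ true

arcCount : ∀ {n} → Digraph n → ℕ
arcCount {n} G =
  sum (map (λ u → sum (map (λ v → if adj G u v then 1 else 0) (allFin n))) (allFin n))

-- IsWalk G u v xs : the vertex sequence xs = x₀ x₁ … x_ℓ is a walk from u to v
-- (x₀ = u, x_ℓ = v, xᵢ → xᵢ₊₁). Its length is ℓ = length xs - 1.
data IsWalk {n : ℕ} (G : Digraph n) : Fin n → Fin n → List (Fin n) → Set where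
  trivial : ∀ {u} → IsWalk G u u (u ∷ [])
  step    : ∀ {u w v xs} → Arc G u w → IsWalk G w v xs → IsWalk G u v (u ∷ xs)

-- k-geodetic: for every ordered pair (u,v) there is at most one u,v-walk of
-- length at most k (i.e. with at most k+1 vertices in its sequence).
KGeodetic : ∀ {n} → ℕ → Digraph n → Set
KGeodetic {n} k G =
  ∀ (u v : Fin n) (xs ys : List (Fin n)) →
  IsWalk G u v xs → length xs ≤ suc k →
  IsWalk G u v ys → length ys ≤ suc k →
  xs ≡ ys

IsEx : ℕ → ℕ → ℕ → Set
IsEx n k m =
  (∀ (G : Digraph n) → KGeodetic k G → arcCount G ≤ m) ×
  Σ (Digraph n) (λ G → KGeodetic k G × arcCount G ≡ m)

-- For k ≥ 2 a k-geodetic digraph has no 2-cycles, no transitive triangles and no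
-- two distinct 2-paths with the same ends, so its underlying graph is simple and
-- every triangle in it is a directed 3-cycle.  This drives a Mantel-type induction.
-- Deleting the ends of an arc uv, another vertex is joined to at most one of u, v
-- unless it closes a directed triangle with them; deleting a directed triangle, another
-- vertex is joined to at most one of its corners, for otherwise two 2-paths would share
-- their ends.  Hence n vertices span at most n²/4 arcs, except for n = 3 where the
-- directed triangle has three arcs.  The bound is attained by orienting the balanced
-- complete bipartite graph from one side to the other: then there are no walks of
-- length 2 at all.
module Submission where

open import Defs
open import Data.Bool using (Bool; true; false; if_then_else_; _∧_; not)
import Data.Bool.Properties as Bool
open import Data.Empty using (⊥-elim)
open import Data.Fin using (Fin; toℕ) renaming (zero to fzero; suc to fsuc)
open import Data.List using (List; []; _∷_; _++_; length; map; allFin)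
open import Data.List.Properties using (map-cong; map-tabulate; length-tabulate)
open import Data.List.Membership.Propositional using (_∈_; find; lose)
open import Data.List.Membership.Propositional.Properties using (∈-∃++)
open import Data.List.Relation.Unary.Any using (here; there; any?)
open import Data.List.Relation.Unary.All using (_∷_)
import Data.List.Relation.Unary.All as All
open import Data.List.Relation.Unary.AllPairs using (_∷_)
open import Data.List.Relation.Unary.Unique.Propositional using (Unique)
open import Data.List.Relation.Unary.Unique.Propositional.Properties using (allFin⁺; drop⁺)
open import Data.List.Relation.Binary.Permutation.Propositional
  using (_↭_; ↭-sym; ↭-trans; ↭-prep; ↭⇒↭ₛ)
open import Data.List.Relation.Binary.Permutation.Propositional.Properties
  using (∈-resp-↭; ↭-length; map⁺; shift)
import Data.List.Relation.Binary.Permutation.Setoid.Properties as SetoidPerm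
open import Data.Nat using (ℕ; zero; suc; _+_; _*_; _∸_; _≤_; _<_; z≤n; s≤s; _<ᵇ_)
open import Data.Nat.Properties
open import Algebra.Properties.CommutativeSemigroup +-commutativeSemigroup using (interchange)
open import Data.Nat.DivMod using (_/_; m*n/n≡m; /-monoˡ-≤; +-distrib-/-∣ʳ)
open import Data.Nat.Divisibility using (n∣m*n)
open import Data.Nat.Induction using (<-wellFounded)
open import Data.Nat.ListAction using (sum)
open import Data.Nat.ListAction.Properties using (sum-↭)
open import Data.Nat.Tactic.RingSolver using (solve-∀)
open import Data.Product using (Σ; ∃; ∃₂; ∃-syntax; _×_; _,_)
open import Data.Sum using (_⊎_; inj₁; inj₂)
open import Function using (_∘_; id)
open import Induction.WellFounded using (Acc; acc)
open import Relation.Binary.PropositionalEquality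
open import Relation.Nullary using (¬_; Dec; yes; no)
open import Relation.Nullary.Decidable using (_×-dec_)

boolToℕ : Bool → ℕ
boolToℕ b = if b then 1 else 0

module _ {A : Set} where

  sum-map-+ : (f g : A → ℕ) (xs : List A) →
              sum (map (λ x → f x + g x) xs) ≡ sum (map f xs) + sum (map g xs)
  sum-map-+ f g []       = refl
  sum-map-+ f g (x ∷ xs) =
    trans (cong (f x + g x +_) (sum-map-+ f g xs)) (interchange (f x) (g x) _ _)

  sum-map-*ʳ : (f : A → ℕ) (c : ℕ) (xs : List A) →
               sum (map (λ x → f x * c) xs) ≡ sum (map f xs) * c
  sum-map-*ʳ f c []       = refl
  sum-map-*ʳ f c (x ∷ xs) =
    trans (cong (f x * c +_) (sum-map-*ʳ f c xs)) (sym (*-distribʳ-+ c (f x) _))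

  sum-map-≡0 : (f : A → ℕ) (xs : List A) → (∀ {x} → x ∈ xs → f x ≡ 0) → sum (map f xs) ≡ 0
  sum-map-≡0 f []       _ = refl
  sum-map-≡0 f (x ∷ xs) h = cong₂ _+_ (h (here refl)) (sum-map-≡0 f xs (h ∘ there))

  sum-map-≤-length : (f : A → ℕ) (xs : List A) → (∀ {x} → x ∈ xs → f x ≤ 1) →
                     sum (map f xs) ≤ length xs
  sum-map-≤-length f []       _ = z≤n
  sum-map-≤-length f (x ∷ xs) h = +-mono-≤ (h (here refl)) (sum-map-≤-length f xs (h ∘ there))

  ∈-∷⁻ : ∀ {x y : A} {xs} → x ∈ y ∷ xs → y ≢ x → x ∈ xs
  ∈-∷⁻ (here x≡y) y≢x = ⊥-elim (y≢x (sym x≡y))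
  ∈-∷⁻ (there x∈xs) _ = x∈xs

  ∈⇒↭∷ : ∀ {x : A} {xs} → x ∈ xs → ∃ λ ys → xs ↭ x ∷ ys
  ∈⇒↭∷ x∈xs with ys , zs , refl ← ∈-∃++ x∈xs = ys ++ zs , shift _ ys zs

  ∈⇒↭∷∷ : ∀ {x y : A} {xs} → x ∈ xs → y ∈ xs → x ≢ y → ∃ λ zs → xs ↭ x ∷ y ∷ zs
  ∈⇒↭∷∷ x∈xs y∈xs x≢y =
    let ys , xs↭x∷ys = ∈⇒↭∷ x∈xs
        zs , ys↭y∷zs = ∈⇒↭∷ (∈-∷⁻ (∈-resp-↭ xs↭x∷ys y∈xs) x≢y)
    in  zs , ↭-trans xs↭x∷ys (↭-prep _ ys↭y∷zs)

  ∈⇒↭∷∷∷ : ∀ {x y z : A} {xs} → x ∈ xs → y ∈ xs → z ∈ xs → x ≢ y → x ≢ z → y ≢ z →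
           ∃ λ ws → xs ↭ x ∷ y ∷ z ∷ ws
  ∈⇒↭∷∷∷ x∈xs y∈xs z∈xs x≢y x≢z y≢z =
    let zs , xs↭x∷y∷zs = ∈⇒↭∷∷ x∈xs y∈xs x≢y
        ws , zs↭z∷ws   = ∈⇒↭∷ (∈-∷⁻ (∈-∷⁻ (∈-resp-↭ xs↭x∷y∷zs z∈xs) x≢z) y≢z)
    in  ws , ↭-trans xs↭x∷y∷zs (↭-prep _ (↭-prep _ zs↭z∷ws))

  Unique-resp-↭ : ∀ {xs ys : List A} → xs ↭ ys → Unique xs → Unique ys
  Unique-resp-↭ p = SetoidPerm.Unique-resp-↭ (setoid A) (↭⇒↭ₛ p)

pairwise≤1⇒sum≤1 : ∀ {a b c} → a + b ≤ 1 → b + c ≤ 1 → a + c ≤ 1 → a + b + c ≤ 1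
pairwise≤1⇒sum≤1 {zero}                   _        b+c≤1 _        = b+c≤1
pairwise≤1⇒sum≤1 {suc zero} {zero} {zero} _        _     _        = ≤-refl
pairwise≤1⇒sum≤1 {suc zero} {zero} {suc _} _       _     (s≤s ())
pairwise≤1⇒sum≤1 {suc zero} {suc _}       (s≤s ()) _     _
pairwise≤1⇒sum≤1 {suc (suc _)}            (s≤s ()) _     _

scaled-sum-≤ : ∀ c {m d e b} → d ≤ m → 4 * e ≤ b → 4 * (c + d + e) ≤ 4 * c + 4 * m + b
scaled-sum-≤ c {m} {d} {e} {b} d≤m e≤b = begin
  4 * (c + d + e)         ≡⟨ *-distribˡ-+ 4 (c + d) e ⟩
  4 * (c + d) + 4 * e     ≡⟨ cong (_+ 4 * e) (*-distribˡ-+ 4 c d) ⟩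
  4 * c + 4 * d + 4 * e   ≤⟨ +-mono-≤ (+-monoʳ-≤ (4 * c) (*-monoʳ-≤ 4 d≤m)) e≤b ⟩
  4 * c + 4 * m + b       ∎
  where open ≤-Reasoning

edge-step : ∀ {m d e} → d ≤ m → 4 * e ≤ m * m → 4 * (1 + d + e) ≤ (2 + m) * (2 + m)
edge-step {m} d≤m e≤ = ≤-trans (scaled-sum-≤ 1 d≤m e≤) (≤-reflexive (square m))
  where
  square : ∀ m → 4 * 1 + 4 * m + m * m ≡ (2 + m) * (2 + m)
  square = solve-∀

-- A directed triangle has 3 arcs, more than ⌊3²/4⌋.
excess : ℕ → ℕ
excess 3 = 3
excess _ = 0

excess-≥4 : ∀ {n} → 4 ≤ n → excess n ≡ 0
excess-≥4 (s≤s (s≤s (s≤s (s≤s _)))) = refl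

triangle-step : ∀ m {d e} → d ≤ m → 4 * e ≤ m * m + excess m →
                4 * (3 + d + e) ≤ (3 + m) * (3 + m) + excess (3 + m)
triangle-step 1 {e = zero}  d≤1 _        = *-monoʳ-≤ 4 (+-monoˡ-≤ 0 (+-monoʳ-≤ 3 d≤1))
triangle-step 1 {e = suc e} _   e≤1 = ⊥-elim (≤⇒≯ e≤1 (subst (1 <_) (sym (*-suc 4 e)) (s≤s (s≤s z≤n))))
triangle-step 0 d≤0 e≤ = ≤-trans (scaled-sum-≤ 3 d≤0 e≤) ≤-refl
triangle-step 2 d≤2 e≤ = ≤-trans (scaled-sum-≤ 3 d≤2 e≤) (n≤1+n 24)
triangle-step 3 d≤3 e≤ = ≤-trans (scaled-sum-≤ 3 d≤3 e≤) ≤-refl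
triangle-step m@(suc (suc (suc (suc j)))) d≤m e≤ =
  ≤-trans (scaled-sum-≤ 3 d≤m e≤) (≤-trans (m≤m+n _ (5 + 2 * j)) (≤-reflexive (square j)))
  where
  square : ∀ j → 4 * 3 + 4 * (4 + j) + ((4 + j) * (4 + j) + 0) + (5 + 2 * j) ≡ (7 + j) * (7 + j) + 0
  square = solve-∀

module _ {n : ℕ} (G : Digraph n) where

  arcs : Fin n → Fin n → ℕ
  arcs u v = boolToℕ (adj G u v)

  link : Fin n → Fin n → ℕ
  link u v = arcs u v + arcs v u

  degreeIn : List (Fin n) → Fin n → ℕ
  degreeIn T a = sum (map (link a) T)

  arcsWithin : List (Fin n) → ℕ
  arcsWithin S = sum (map (λ u → sum (map (arcs u) S)) S)

  arcsWithin-↭ : ∀ {S S′} → S ↭ S′ → arcsWithin S ≡ arcsWithin S′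
  arcsWithin-↭ {S} {S′} p = begin
    sum (map (λ u → sum (map (arcs u) S)) S)   ≡⟨ cong sum (map-cong (λ u → sum-↭ (map⁺ (arcs u) p)) S) ⟩
    sum (map (λ u → sum (map (arcs u) S′)) S)  ≡⟨ sum-↭ (map⁺ _ p) ⟩
    sum (map (λ u → sum (map (arcs u) S′)) S′) ∎
    where open ≡-Reasoning

  arcsWithin-∷ : ∀ a S → arcsWithin (a ∷ S) ≡ degreeIn S a + arcsWithin S
  arcsWithin-∷ a S = begin
    (arcs a a + out a) + sum (map (λ u → arcs u a + out u) S)
      ≡⟨ cong₂ _+_ (cong (λ b → boolToℕ b + out a) (loopless G a)) (sum-map-+ (λ u → arcs u a) out S) ⟩
    out a + (into a + arcsWithin S)
      ≡⟨ +-assoc (out a) _ _ ⟨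
    (out a + into a) + arcsWithin S
      ≡⟨ cong (_+ arcsWithin S) (sum-map-+ (arcs a) (λ u → arcs u a) S) ⟨
    degreeIn S a + arcsWithin S ∎
    where
    open ≡-Reasoning
    out into : Fin n → ℕ
    out u = sum (map (arcs u) S)
    into v = sum (map (λ u → arcs u v) S)

  arcsWithin-≡0 : ∀ S → (∀ {u v} → u ∈ S → v ∈ S → adj G u v ≡ false) → arcsWithin S ≡ 0
  arcsWithin-≡0 S none =
    sum-map-≡0 _ S λ u∈S → sum-map-≡0 _ S λ v∈S → cong boolToℕ (none u∈S v∈S)

  Arc⇒≢ : ∀ {u v} → Arc G u v → u ≢ v
  Arc⇒≢ {u} uv refl with () ← trans (sym uv) (loopless G u)

  arc-or-none : ∀ S → (∃₂ λ u v → u ∈ S × v ∈ S × Arc G u v) ⊎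
                      (∀ {u v} → u ∈ S → v ∈ S → adj G u v ≡ false)
  arc-or-none S with any? (λ u → any? (λ v → adj G u v Bool.≟ true) S) S
  ... | yes ∃arc = let u , u∈S , ∃v = find ∃arc ; v , v∈S , uv = find ∃v in
                   inj₁ (u , v , u∈S , v∈S , uv)
  ... | no ∄arc  = inj₂ λ u∈S v∈S → Bool.¬-not λ uv → ∄arc (lose u∈S (lose v∈S uv))

  DirectedTriangle : Fin n → Fin n → Fin n → Set
  DirectedTriangle u v x = Arc G u v × Arc G v x × Arc G x u

  directedTriangle? : ∀ u v x → Dec (DirectedTriangle u v x)
  directedTriangle? u v x =
    (adj G u v Bool.≟ true) ×-dec (adj G v x Bool.≟ true) ×-dec (adj G x u Bool.≟ true)

  TriangleFree : List (Fin n) → Set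
  TriangleFree S = ∀ {u v x} → u ∈ S → v ∈ S → x ∈ S → ¬ DirectedTriangle u v x

  triangle-or-free : ∀ S → (∃[ u ] ∃[ v ] ∃[ x ] u ∈ S × v ∈ S × x ∈ S × DirectedTriangle u v x) ⊎
                           TriangleFree S
  triangle-or-free S with any? (λ u → any? (λ v → any? (directedTriangle? u v) S) S) S
  ... | yes ∃tri = let u , u∈S , ∃v = find ∃tri ; v , v∈S , ∃x = find ∃v ; x , x∈S , t = find ∃x in
                   inj₁ (u , v , x , u∈S , v∈S , x∈S , t)
  ... | no ∄tri  = inj₂ λ u∈S v∈S x∈S t → ∄tri (lose u∈S (lose v∈S (lose x∈S t)))

  arcsWithin-bound-resp-↭ : (f : ℕ → ℕ) → ∀ {S S′} → S ↭ S′ →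
                           4 * arcsWithin S′ ≤ f (length S′) → 4 * arcsWithin S ≤ f (length S)
  arcsWithin-bound-resp-↭ f S↭S′ =
    subst₂ (λ a l → 4 * a ≤ f l) (sym (arcsWithin-↭ S↭S′)) (sym (↭-length S↭S′))

  TriangleFree-⊆ : ∀ {S S′} → (∀ {y} → y ∈ S′ → y ∈ S) → TriangleFree S → TriangleFree S′
  TriangleFree-⊆ S′⊆S free u∈ v∈ x∈ = free (S′⊆S u∈) (S′⊆S v∈) (S′⊆S x∈)

  KGeodetic-weaken : ∀ {j k} → j ≤ k → KGeodetic k G → KGeodetic j G
  KGeodetic-weaken j≤k geo u v xs ys xs-walk |xs|≤ ys-walk |ys|≤ =
    geo u v xs ys xs-walk (≤-trans |xs|≤ (s≤s j≤k)) ys-walk (≤-trans |ys|≤ (s≤s j≤k))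

  module TwoGeodetic (geo : KGeodetic 2 G) where

    no-2-cycle : ∀ {a b} → Arc G a b → ¬ Arc G b a
    no-2-cycle ab ba with () ← geo _ _ _ _ trivial (s≤s z≤n) (step ab (step ba trivial)) ≤-refl

    no-transitive-triangle : ∀ {a b c} → Arc G a b → Arc G b c → ¬ Arc G a c
    no-transitive-triangle ab bc ac
      with () ← geo _ _ _ _ (step ab (step bc trivial)) ≤-refl (step ac trivial) (s≤s (s≤s z≤n))

    2-path-unique : ∀ {a b b′ c} → Arc G a b → Arc G b c → Arc G a b′ → Arc G b′ c → b ≡ b′
    2-path-unique ab bc ab′ b′c
      with refl ← geo _ _ _ _ (step ab (step bc trivial)) ≤-refl (step ab′ (step b′c trivial)) ≤-refl
      = refl

    link≤1 : ∀ a b → link a b ≤ 1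
    link≤1 a b with adj G a b in ab | adj G b a in ba
    ... | false | false = z≤n
    ... | false | true  = ≤-refl
    ... | true  | false = ≤-refl
    ... | true  | true  = ⊥-elim (no-2-cycle ab ba)

    link-pair≤1 : ∀ {a b y} → Arc G a b → ¬ (Arc G b y × Arc G y a) → link a y + link b y ≤ 1
    link-pair≤1 {a} {b} {y} ab ¬closes
      with adj G a y in ay | adj G y a in ya | adj G b y in by | adj G y b in yb
    ... | true  | true  | _     | _     = ⊥-elim (no-2-cycle ay ya)
    ... | _     | _     | true  | true  = ⊥-elim (no-2-cycle by yb)
    ... | false | false | false | false = z≤n
    ... | false | false | false | true  = ≤-refl
    ... | false | false | true  | false = ≤-refl
    ... | false | true  | false | false = ≤-refl
    ... | true  | false | false | false = ≤-refl
    ... | false | true  | false | true  = ⊥-elim (no-transitive-triangle ya ab yb)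
    ... | true  | false | false | true  = ⊥-elim (no-transitive-triangle ay yb ab)
    ... | true  | false | true  | false = ⊥-elim (no-transitive-triangle ab by ay)
    ... | false | true  | true  | false = ⊥-elim (¬closes (refl , refl))

    arcsWithin-edge : ∀ u v T →
                      arcsWithin (u ∷ v ∷ T) ≤ 1 + (degreeIn T u + degreeIn T v) + arcsWithin T
    arcsWithin-edge u v T = begin
      arcsWithin (u ∷ v ∷ T)                                    ≡⟨ arcsWithin-∷ u (v ∷ T) ⟩
      (link u v + degreeIn T u) + arcsWithin (v ∷ T)            ≡⟨ cong (link u v + degreeIn T u +_) (arcsWithin-∷ v T) ⟩
      (link u v + degreeIn T u) + (degreeIn T v + arcsWithin T) ≡⟨ regroup (link u v) _ _ _ ⟩
      link u v + (degreeIn T u + degreeIn T v) + arcsWithin T   ≤⟨ +-monoˡ-≤ _ (+-monoˡ-≤ _ (link≤1 u v)) ⟩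
      1 + (degreeIn T u + degreeIn T v) + arcsWithin T          ∎
      where
      open ≤-Reasoning
      regroup : ∀ a b c d → (a + b) + (c + d) ≡ a + (b + c) + d
      regroup = solve-∀

    arcsWithin-triangle : ∀ u v x T →
      arcsWithin (u ∷ v ∷ x ∷ T) ≤ 3 + (degreeIn T u + degreeIn T v + degreeIn T x) + arcsWithin T
    arcsWithin-triangle u v x T = begin
      arcsWithin (u ∷ v ∷ x ∷ T)
        ≡⟨ arcsWithin-∷ u (v ∷ x ∷ T) ⟩
      (link u v + (link u x + degreeIn T u)) + arcsWithin (v ∷ x ∷ T)
        ≤⟨ +-mono-≤ (+-mono-≤ (link≤1 u v) (+-monoˡ-≤ _ (link≤1 u x))) (arcsWithin-edge v x T) ⟩
      (1 + (1 + degreeIn T u)) + (1 + (degreeIn T v + degreeIn T x) + arcsWithin T)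
        ≡⟨ regroup (degreeIn T u) _ _ _ ⟩
      3 + (degreeIn T u + degreeIn T v + degreeIn T x) + arcsWithin T
        ∎
      where
      open ≤-Reasoning
      regroup : ∀ a b c d → (1 + (1 + a)) + (1 + (b + c) + d) ≡ 3 + (a + b + c) + d
      regroup = solve-∀

    edge-bound : ∀ {u v} T → Arc G u v → TriangleFree (u ∷ v ∷ T) →
                 4 * arcsWithin T ≤ length T * length T →
                 4 * arcsWithin (u ∷ v ∷ T) ≤ (2 + length T) * (2 + length T)
    edge-bound {u} {v} T uv free IH =
      ≤-trans (*-monoʳ-≤ 4 (arcsWithin-edge u v T)) (edge-step degrees≤ IH)
      where
      degrees≤ : degreeIn T u + degreeIn T v ≤ length T
      degrees≤ = subst (_≤ length T) (sum-map-+ (link u) (link v) T)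
        (sum-map-≤-length _ T λ y∈T → link-pair≤1 uv λ (vy , yu) →
          free (here refl) (there (here refl)) (there (there y∈T)) (uv , vy , yu))

    mantel : ∀ S → TriangleFree S → 4 * arcsWithin S ≤ length S * length S
    mantel S = go S (<-wellFounded (length S))
      where
      go : ∀ S → Acc _<_ (length S) → TriangleFree S → 4 * arcsWithin S ≤ length S * length S
      go S (acc rec) free with arc-or-none S
      ... | inj₂ none = subst (λ a → 4 * a ≤ length S * length S) (sym (arcsWithin-≡0 S none)) z≤n
      ... | inj₁ (u , v , u∈S , v∈S , uv) with T , S↭ ← ∈⇒↭∷∷ u∈S v∈S (Arc⇒≢ uv) =
        arcsWithin-bound-resp-↭ (λ l → l * l) S↭ (edge-bound T uv free′ IH)
        where
        free′ : TriangleFree (u ∷ v ∷ T)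
        free′ = TriangleFree-⊆ (∈-resp-↭ (↭-sym S↭)) free
        IH : 4 * arcsWithin T ≤ length T * length T
        IH = go T (rec (subst (length T <_) (sym (↭-length S↭)) (s≤s (n≤1+n _))))
                (TriangleFree-⊆ (there ∘ there) free′)

    triangle-bound : ∀ {u v x} T → DirectedTriangle u v x → Unique (u ∷ v ∷ x ∷ T) →
                     4 * arcsWithin T ≤ length T * length T + excess (length T) →
                     4 * arcsWithin (u ∷ v ∷ x ∷ T) ≤
                       (3 + length T) * (3 + length T) + excess (3 + length T)
    triangle-bound {u} {v} {x} T (uv , vx , xu) ((_ ∷ _ ∷ u∉T) ∷ (_ ∷ v∉T) ∷ x∉T ∷ _) IH =
      ≤-trans (*-monoʳ-≤ 4 (arcsWithin-triangle u v x T)) (triangle-step (length T) degrees≤ IH)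
      where
      -- A vertex y joined to two corners would give a second 2-path beside the triangle.
      joined≤1 : ∀ {y} → y ∈ T → link u y + link v y + link x y ≤ 1
      joined≤1 {y} y∈T = pairwise≤1⇒sum≤1 {link u y} {link v y} {link x y}
        (link-pair≤1 uv λ (vy , yu) → All.lookup x∉T y∈T (sym (2-path-unique vy yu vx xu)))
        (link-pair≤1 vx λ (xy , yv) → All.lookup u∉T y∈T (sym (2-path-unique xy yv xu uv)))
        (subst (_≤ 1) (+-comm (link x _) _)
          (link-pair≤1 xu λ (uy , yx) → All.lookup v∉T y∈T (sym (2-path-unique uy yx uv vx))))
      degrees≤ : degreeIn T u + degreeIn T v + degreeIn T x ≤ length T
      degrees≤ = subst (_≤ length T)
        (trans (sum-map-+ _ (link x) T) (cong (_+ degreeIn T x) (sum-map-+ (link u) (link v) T)))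
        (sum-map-≤-length _ T joined≤1)

    arcsWithin-bound : ∀ S → Unique S → 4 * arcsWithin S ≤ length S * length S + excess (length S)
    arcsWithin-bound S = go S (<-wellFounded (length S))
      where
      go : ∀ S → Acc _<_ (length S) → Unique S →
           4 * arcsWithin S ≤ length S * length S + excess (length S)
      go S (acc rec) unique with triangle-or-free S
      ... | inj₂ free = ≤-trans (mantel S free) (m≤m+n _ _)
      ... | inj₁ (u , v , x , u∈S , v∈S , x∈S , t@(uv , vx , xu))
        with T , S↭ ← ∈⇒↭∷∷∷ u∈S v∈S x∈S (Arc⇒≢ uv) (≢-sym (Arc⇒≢ xu)) (Arc⇒≢ vx) =
        arcsWithin-bound-resp-↭ (λ l → l * l + excess l) S↭ (triangle-bound T t unique′ IH)
        where
        unique′ : Unique (u ∷ v ∷ x ∷ T)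
        unique′ = Unique-resp-↭ S↭ unique
        IH : 4 * arcsWithin T ≤ length T * length T + excess (length T)
        IH = go T (rec (subst (length T <_) (sym (↭-length S↭)) (s≤s (m≤n+m _ 2))))
                (drop⁺ 3 unique′)

arcCount-upper : ∀ {n} (G : Digraph n) → 4 ≤ n → KGeodetic 2 G → arcCount G * 4 ≤ n * n
arcCount-upper {n} G 4≤n geo = begin
  arcCount G * 4                  ≡⟨ *-comm (arcCount G) 4 ⟩
  4 * arcsWithin G (allFin n)     ≤⟨ arcsWithin-bound (allFin n) (allFin⁺ n) ⟩
  L * L + excess L                ≡⟨ cong (λ l → l * l + excess l) (length-tabulate {n = n} id) ⟩
  n * n + excess n                ≡⟨ cong (n * n +_) (excess-≥4 4≤n) ⟩
  n * n + 0                       ≡⟨ +-identityʳ (n * n) ⟩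
  n * n                           ∎
  where
  open ≤-Reasoning
  open TwoGeodetic G geo
  L : ℕ
  L = length (allFin n)

below : ∀ {n} → ℕ → Fin n → Bool
below p u = toℕ u <ᵇ p

bipartite : (n p : ℕ) → Digraph n
bipartite n p = record
  { adj      = λ u v → below p u ∧ not (below p v)
  ; loopless = λ u → Bool.∧-inverseʳ (below p u)
  }

module _ {n p : ℕ} where

  bipartite-no-2-path : ∀ {a b c} → Arc (bipartite n p) a b → ¬ Arc (bipartite n p) b c
  bipartite-no-2-path {a} {b} ab bc with below p b
  ... | false with () ← bc
  ... | true  with () ← trans (sym (Bool.∧-zeroʳ (below p a))) ab

  bipartite-walk-unique : ∀ {u v xs ys} →
                          IsWalk (bipartite n p) u v xs → IsWalk (bipartite n p) u v ys → xs ≡ ys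
  bipartite-walk-unique trivial               trivial               = refl
  bipartite-walk-unique (step _ trivial)      (step _ trivial)      = refl
  bipartite-walk-unique trivial               (step uu trivial)     = ⊥-elim (Arc⇒≢ (bipartite n p) uu refl)
  bipartite-walk-unique (step uu trivial)     trivial               = ⊥-elim (Arc⇒≢ (bipartite n p) uu refl)
  bipartite-walk-unique (step ab (step bc _)) _                     = ⊥-elim (bipartite-no-2-path ab bc)
  bipartite-walk-unique _                     (step ab (step bc _)) = ⊥-elim (bipartite-no-2-path ab bc)

  bipartite-geodetic : ∀ k → KGeodetic k (bipartite n p)
  bipartite-geodetic k u v xs ys xs-walk _ ys-walk _ = bipartite-walk-unique xs-walk ys-walk

sum-allFin-suc : ∀ {n} (f : Fin (suc n) → ℕ) →
                 sum (map f (allFin (suc n))) ≡ f fzero + sum (map (f ∘ fsuc) (allFin n))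
sum-allFin-suc f =
  cong (λ xs → f fzero + sum xs) (trans (map-tabulate fsuc f) (sym (map-tabulate id (f ∘ fsuc))))

count-below : ∀ n p → p ≤ n → sum (map (boolToℕ ∘ below p) (allFin n)) ≡ p
count-below zero    zero    _         = refl
count-below (suc n) zero    _         =
  trans (sum-allFin-suc {n} (boolToℕ ∘ below 0)) (count-below n zero z≤n)
count-below (suc n) (suc p) (s≤s p≤n) =
  trans (sum-allFin-suc {n} (boolToℕ ∘ below (suc p))) (cong suc (count-below n p p≤n))

count-not-below : ∀ n p → p ≤ n → sum (map (boolToℕ ∘ not ∘ below p) (allFin n)) ≡ n ∸ p
count-not-below zero    zero    _         = refl
count-not-below (suc n) zero    _         =
  trans (sum-allFin-suc {n} (boolToℕ ∘ not ∘ below 0)) (cong suc (count-not-below n zero z≤n))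
count-not-below (suc n) (suc p) (s≤s p≤n) =
  trans (sum-allFin-suc {n} (boolToℕ ∘ not ∘ below (suc p))) (count-not-below n p p≤n)

sum-map-boolToℕ-∧ : ∀ {A : Set} b (g : A → Bool) xs →
                    sum (map (λ x → boolToℕ (b ∧ g x)) xs) ≡ boolToℕ b * sum (map (boolToℕ ∘ g) xs)
sum-map-boolToℕ-∧ true  g xs = sym (+-identityʳ _)
sum-map-boolToℕ-∧ false g xs = sum-map-≡0 _ xs (λ _ → refl)

bipartite-arcCount : ∀ n p → p ≤ n → arcCount (bipartite n p) ≡ p * (n ∸ p)
bipartite-arcCount n p p≤n = begin
  arcCount (bipartite n p)
    ≡⟨ cong sum (map-cong (λ u → sum-map-boolToℕ-∧ (below p u) (not ∘ below p) (allFin n)) (allFin n)) ⟩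
  sum (map (λ u → boolToℕ (below p u) * sum (map (boolToℕ ∘ not ∘ below p) (allFin n))) (allFin n))
    ≡⟨ sum-map-*ʳ (boolToℕ ∘ below p) _ (allFin n) ⟩
  sum (map (boolToℕ ∘ below p) (allFin n)) * sum (map (boolToℕ ∘ not ∘ below p) (allFin n))
    ≡⟨ cong₂ _*_ (count-below n p p≤n) (count-not-below n p p≤n) ⟩
  p * (n ∸ p) ∎
  where open ≡-Reasoning

square-/4-step : ∀ s → (2 + s) * (2 + s) / 4 ≡ s * s / 4 + suc s
square-/4-step s = begin
  (2 + s) * (2 + s) / 4      ≡⟨ cong (_/ 4) (expand s) ⟩
  (s * s + suc s * 4) / 4    ≡⟨ +-distrib-/-∣ʳ (s * s) (n∣m*n (suc s)) ⟩
  s * s / 4 + suc s * 4 / 4  ≡⟨ cong (s * s / 4 +_) (m*n/n≡m (suc s) 4) ⟩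
  s * s / 4 + suc s          ∎
  where
  open ≡-Reasoning
  expand : ∀ s → (2 + s) * (2 + s) ≡ s * s + suc s * 4
  expand = solve-∀

balanced-split : ∀ n → ∃₂ λ p q → p + q ≡ n × p * q ≡ n * n / 4
balanced-split 0 = 0 , 0 , refl , refl
balanced-split 1 = 0 , 1 , refl , refl
balanced-split (suc (suc n)) with p , q , refl , pq≡ ← balanced-split n =
  suc p , suc q , cong suc (+-suc p q) , (begin
    suc p * suc q                          ≡⟨ expand p q ⟩
    p * q + suc (p + q)                    ≡⟨ cong (_+ suc (p + q)) pq≡ ⟩
    (p + q) * (p + q) / 4 + suc (p + q)    ≡⟨ square-/4-step (p + q) ⟨
    (2 + (p + q)) * (2 + (p + q)) / 4      ∎)
  where
  open ≡-Reasoning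
  expand : ∀ p q → suc p * suc q ≡ p * q + suc (p + q)
  expand = solve-∀

extremal-digraph : ∀ n k → Σ (Digraph n) λ G → KGeodetic k G × arcCount G ≡ n * n / 4
extremal-digraph n k with p , q , refl , pq≡ ← balanced-split n =
  bipartite (p + q) p , bipartite-geodetic {p = p} k ,
  trans (bipartite-arcCount (p + q) p (m≤m+n p q)) (trans (cong (p *_) (m+n∸m≡n p q)) pq≡)

theorem8 : (n k : ℕ) → 4 ≤ n → 2 ≤ k → IsEx n k ((n * n) / 4)
theorem8 n k 4≤n 2≤k = upper , extremal-digraph n k
  where
  upper : ∀ G → KGeodetic k G → arcCount G ≤ n * n / 4
  upper G geo = subst (_≤ n * n / 4) (m*n/n≡m (arcCount G) 4)
    (/-monoˡ-≤ 4 (arcCount-upper G 4≤n (KGeodetic-weaken G 2≤k geo)))
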